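{- Let $\Gamma$ be a finite, simple, strongly connected digraph and $r$ a positive integer. If $\Gamma$ has an arc $(x,y)$ with $\partial(y,x)=r$, then $\dim(\Gamma)\leq |V(\Gamma)|-r$.
   Context: $\partial(x,y)$ is the length of a shortest directed path from $x$ to $y$, $\tilde\partial(x,y)=(\partial(x,y),\partial(y,x))$. A vertex set $\{w_1,\dots,w_m\}$ is weakly resolving if $(\tilde\partial(w_1,u),\dots,\tilde\partial(w_m,u))\neq(\tilde\partial(w_1,v),\dots,\tilde\partial(w_m,v))$ for all distinct $u,v$; $\dim(\Gamma)$ is the minimum size of such a set. -}

module Defs where

open import Data.Nat using (ℕ; zero; suc; _≤_)
open import Data.Fin using (Fin)
open import Data.Fin.Subset using (Subset; _∈_)
open import Data.Product using (∃; _×_)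
open import Relation.Binary.PropositionalEquality using (_≡_; _≢_)
open import Relation.Nullary using (¬_)

Digraph : ℕ → Set₁
Digraph n = Fin n → Fin n → Set

-- simple: no loops (multiple arcs are impossible by representation)
Simple : ∀ {n} → Digraph n → Set
Simple {n} G = (x : Fin n) → ¬ G x x

data Walk {n} (G : Digraph n) : Fin n → Fin n → ℕ → Set where
  here : ∀ {x} → Walk G x x 0
  step : ∀ {x y z k} → G x y → Walk G y z k → Walk G x z (suc k)

StronglyConnected : ∀ {n} → Digraph n → Set
StronglyConnected {n} G = (x y : Fin n) → ∃ λ k → Walk G x y k

-- ∂(x,y) = d : d is the length of a shortest directed path from x to y
-- (shortest walks are paths)
Dist : ∀ {n} → Digraph n → Fin n → Fin n → ℕ → Set
Dist G x y d = Walk G x y d × (∀ k → Walk G x y k → d ≤ k)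

SameRep : ∀ {n} → Digraph n → Subset n → Fin n → Fin n → Set
SameRep {n} G W u v = (w : Fin n) → w ∈ W →
  ((a b : ℕ) → Dist G w u a → Dist G w v b → a ≡ b) ×
  ((a b : ℕ) → Dist G u w a → Dist G v w b → a ≡ b)

WeaklyResolving : ∀ {n} → Digraph n → Subset n → Set
WeaklyResolving {n} G W = (u v : Fin n) → u ≢ v → ¬ SameRep G W u v

-- Let y = v₀ → v₁ → ⋯ → v_r = x be a shortest path from y to x, and let W be the
-- complement of {v₀, …, v_{r−1}}; it has n − r elements and contains x. Two
-- vertices outside W are told apart by their distance to x, since ∂(v_i, x) = r − i.
-- A vertex u ∈ W is told apart from every v ≠ u by itself, since ∂(u, u) = 0.
module Submission where

open import Defs
open import Data.Nat using (ℕ; suc; _+_; _≤_; _<_; _∸_; z≤n; s≤s)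
open import Data.Nat.Properties
  using (≤-antisym; ≤-trans; ≮⇒≥; +-cancelˡ-≤; ∸-monoʳ-≤; 1+n≰n; m<m+n; m≤n+m)
open import Data.Nat.Induction using (<-rec)
open import Data.Fin using (Fin; _≟_)
open import Data.Fin.Subset using (Subset; ∣_∣; _∈_; _∉_; ⁅_⁆; _∪_; ⊥; ∁)
open import Data.Fin.Subset.Properties
  using (x∈p∪q⁻; x∈p∪q⁺; x∈⁅y⁆⇒x≡y; x∈⁅x⁆; ∉⊥; q⊆p∪q; p⊂q⇒∣p∣<∣q∣; ∣∁p∣≡n∸∣p∣;
         x∉p⇒x∈∁p; x∉∁p⇒x∈p; _∈?_)
open import Data.Product using (∃; ∃₂; _×_; _,_; proj₁; proj₂)
open import Data.Sum using (_⊎_; inj₁; inj₂)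
open import Data.Empty using (⊥-elim)
open import Relation.Binary.PropositionalEquality using (_≡_; refl; sym; subst)
open import Relation.Nullary using (¬_; yes; no)
open import Relation.Nullary.Decidable using (decidable-stable)

module _ {n : ℕ} {G : Digraph n} where

  private
    variable
      a b c z z₁ z₂ : Fin n
      i j k d d′ : ℕ

  _++_ : Walk G a b i → Walk G b c j → Walk G a c (i + j)
  here     ++ q = q
  step e p ++ q = step e (p ++ q)

  Dist-unique : Dist G a b d → Dist G a b d′ → d ≡ d′
  Dist-unique (p , p-min) (q , q-min) = ≤-antisym (p-min _ q) (q-min _ p)

  Dist-suffix : Walk G a b i → Dist G a c (i + j) → Walk G b c j → Dist G b c j
  Dist-suffix {i = i} p (_ , min) q = q , λ j′ r → +-cancelˡ-≤ i _ j′ (min _ (p ++ r))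

  Dist-refl : Dist G a a 0
  Dist-refl = here , λ _ _ → z≤n

  -- The arc relation is not decidable, so a shortest walk cannot be searched for;
  -- it can only be shown not to be missing.
  walk⇒¬¬Dist : Walk G a b k → ¬ ¬ ∃ (Dist G a b)
  walk⇒¬¬Dist {a = a} {b = b} {k = k} w noDist = <-rec (λ k → ¬ Walk G a b k) noWalk k w
    where
    noWalk : ∀ k → (∀ {j} → j < k → ¬ Walk G a b j) → ¬ Walk G a b k
    noWalk k noShorter w = noDist (k , w , λ j v → ≮⇒≥ (λ j<k → noShorter j<k v))

  tails : Walk G a b k → Subset n
  tails here           = ⊥
  tails (step {x} _ w) = ⁅ x ⁆ ∪ tails w

  ∈tails-step : ∀ {x y} (e : G x y) (w : Walk G y c k) →
                z ∈ tails (step e w) → z ≡ x ⊎ z ∈ tails w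
  ∈tails-step {x = x} e w z∈ with x∈p∪q⁻ ⁅ x ⁆ (tails w) z∈
  ... | inj₁ z∈x = inj₁ (x∈⁅y⁆⇒x≡y x z∈x)
  ... | inj₂ z∈w = inj₂ z∈w

  ∈tails⇒split : (w : Walk G b c k) → z ∈ tails w →
                 ∃₂ λ i j → i + suc j ≡ k × Walk G b z i × Walk G z c (suc j)
  ∈tails⇒split here z∈ = ⊥-elim (∉⊥ z∈)
  ∈tails⇒split (step e w) z∈ with ∈tails-step e w z∈
  ... | inj₁ refl = 0 , _ , refl , here , step e w
  ... | inj₂ z∈w with ∈tails⇒split w z∈w
  ...   | i , j , refl , p , q = suc i , j , refl , step e p , q

  ∈tails⇒Dist-≤ : (w : Walk G b c k) → z ∈ tails w → Dist G z c d → d ≤ k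
  ∈tails⇒Dist-≤ w z∈ (_ , min) with ∈tails⇒split w z∈
  ... | i , j , refl , _ , q = ≤-trans (min _ q) (m≤n+m (suc j) i)

  ∈tails⇒Dist : (w : Walk G b c k) → Dist G b c k → z ∈ tails w → ∃ (Dist G z c)
  ∈tails⇒Dist w D z∈ with ∈tails⇒split w z∈
  ... | _ , j , refl , p , q = suc j , Dist-suffix p D q

  end∉tails : (w : Walk G b c k) → Dist G b c k → c ∉ tails w
  end∉tails w (_ , min) c∈ with ∈tails⇒split w c∈
  ... | i , j , refl , p , _ = 1+n≰n (≤-trans (m<m+n i (s≤s z≤n)) (min _ p))

  Dist-step : ∀ {x y} (e : G x y) (w : Walk G y c k) → Dist G x c (suc k) → Dist G y c k
  Dist-step e w D = Dist-suffix (step e here) D w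

  farther∉tails : (w : Walk G b c k) → Dist G z c (suc k) → z ∉ tails w
  farther∉tails w D z∈ = 1+n≰n (∈tails⇒Dist-≤ w z∈ D)

  tails-card : (w : Walk G b c k) → Dist G b c k → k ≤ ∣ tails w ∣
  tails-card here _ = z≤n
  tails-card (step {x} e w) D = ≤-trans (s≤s (tails-card w (Dist-step e w D))) ∣w∣<∣ew∣
    where
    ∣w∣<∣ew∣ : ∣ tails w ∣ < ∣ tails (step e w) ∣
    ∣w∣<∣ew∣ = p⊂q⇒∣p∣<∣q∣
      (q⊆p∪q ⁅ x ⁆ (tails w) , x , x∈p∪q⁺ (inj₁ (x∈⁅x⁆ x)) , farther∉tails w D)

  tails-Dist-injective : (w : Walk G b c k) → Dist G b c k →
    z₁ ∈ tails w → z₂ ∈ tails w → Dist G z₁ c d → Dist G z₂ c d → z₁ ≡ z₂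
  tails-Dist-injective here _ z₁∈ _ = ⊥-elim (∉⊥ z₁∈)
  tails-Dist-injective (step e w) D z₁∈ z₂∈ D₁ D₂
    with ∈tails-step e w z₁∈ | ∈tails-step e w z₂∈
  ... | inj₁ refl | inj₁ refl = refl
  ... | inj₂ z₁∈w | inj₂ z₂∈w = tails-Dist-injective w (Dist-step e w D) z₁∈w z₂∈w D₁ D₂
  ... | inj₁ refl | inj₂ z₂∈w with Dist-unique D D₁
  ...   | refl = ⊥-elim (farther∉tails w D₂ z₂∈w)
  tails-Dist-injective (step e w) D z₁∈ z₂∈ D₁ D₂ | inj₂ z₁∈w | inj₁ refl with Dist-unique D D₂
  ...   | refl = ⊥-elim (farther∉tails w D₁ z₁∈w)

module _ {n : ℕ} {G : Digraph n} {W : Subset n} where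

  private
    variable
      u v : Fin n

  SameRep-sym : SameRep G W u v → SameRep G W v u
  SameRep-sym same w w∈ =
    (λ a b p q → sym (proj₁ (same w w∈) b a q p)) , (λ a b p q → sym (proj₂ (same w w∈) b a q p))

  SameRep-resolved-by-member : ∀ {k} → u ∈ W → Walk G u v k → SameRep G W u v → u ≡ v
  SameRep-resolved-by-member {u} {v} u∈ w same =
    decidable-stable (u ≟ v) λ u≢v → walk⇒¬¬Dist w λ (d , D) →
      u≢v (Dist₀⇒≡ (subst (Dist G u v) (sym (proj₁ (same u u∈) 0 d Dist-refl D)) D))
    where
    Dist₀⇒≡ : Dist G u v 0 → u ≡ v
    Dist₀⇒≡ (here , _) = refl

  SameRep-resolved-by-end : ∀ {b c k} (w : Walk G b c k) → Dist G b c k → c ∈ W →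
    u ∈ tails w → v ∈ tails w → SameRep G W u v → u ≡ v
  SameRep-resolved-by-end w D c∈ u∈ v∈ same
    with ∈tails⇒Dist w D u∈ | ∈tails⇒Dist w D v∈
  ... | d , Du | d′ , Dv with proj₂ (same _ c∈) d d′ Du Dv
  ...   | refl = tails-Dist-injective w D u∈ v∈ Du Dv

∁tails-weaklyResolving : ∀ {n} {G : Digraph n} → StronglyConnected G →
  ∀ {b c k} (w : Walk G b c k) → Dist G b c k → WeaklyResolving G (∁ (tails w))
∁tails-weaklyResolving sc w D u v u≢v same with u ∈? ∁ (tails w) | v ∈? ∁ (tails w)
... | yes u∈ | _ = u≢v (SameRep-resolved-by-member u∈ (proj₂ (sc u v)) same)
... | no _ | yes v∈ = u≢v (sym (SameRep-resolved-by-member v∈ (proj₂ (sc v u)) (SameRep-sym same)))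
... | no u∉ | no v∉ = u≢v (SameRep-resolved-by-end w D (x∉p⇒x∈∁p (end∉tails w D))
                              (x∉∁p⇒x∈p u∉) (x∉∁p⇒x∈p v∉) same)

lemma4p5 : (n : ℕ) (G : Digraph n) → Simple G → StronglyConnected G →
    (r : ℕ) → 0 < r → (x y : Fin n) → G x y → Dist G y x r →
    ∃ λ (W : Subset n) → WeaklyResolving G W × ∣ W ∣ ≤ n ∸ r
lemma4p5 n G _ sc r _ x y _ D@(P , _) =
  ∁ (tails P) , ∁tails-weaklyResolving sc P D , ∣∁tails∣≤n∸r
  where
  ∣∁tails∣≤n∸r : ∣ ∁ (tails P) ∣ ≤ n ∸ r
  ∣∁tails∣≤n∸r = subst (_≤ n ∸ r) (sym (∣∁p∣≡n∸∣p∣ (tails P))) (∸-monoʳ-≤ n (tails-card P D))
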